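{- Let $M=(X,rk)$ be a matroid of rank $r=rk(X)$ and let $j$ be a nonnegative integer. Then $f_1(M)<j+r$ if and only if \[ [y^j]\,T_M(1,y)=\binom{|X|-j-1}{r-1}. \]
   Context: For a matroid $M=(X,rk)$ with $r=rk(X)$, the Tutte polynomial is $T_M(x,y)=\sum_{A\subseteq X}(x-1)^{r-rk(A)}(y-1)^{|A|-rk(A)}$, and $[y^j]f(y)$ denotes the coefficient of $y^j$. A flat is a set $F\subseteq X$ with $\{e\in X: rk(F\cup\{e\})=rk(F)\}=F$; a hyperplane is a flat of rank $r-1$. $f_1(M)$ is the maximum size of a hyperplane of $M$, i.e. $f_1(M)=\max\{|F|: F \text{ a flat},\ rk(F)=r-1\}$. -}

module Defs where

open import Data.Nat as ℕ using (ℕ; zero; suc; _≤_; _∸_; _⊔_)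
open import Data.Nat.Combinatorics using (_C_)
open import Data.Integer as ℤ using (ℤ; +_; -[1+_])
open import Data.List using (List; []; _∷_; map; foldr; filter; _++_)
open import Data.Vec using (Vec; []; _∷_)
open import Data.Bool using (true; false)
open import Data.Fin using (Fin)
open import Data.Fin.Properties using (all?)
open import Data.Fin.Subset using (Subset; _∈_; _∪_; _∩_; _⊆_; ⁅_⁆; ∣_∣; ⊤)
open import Data.Fin.Subset.Properties using (_∈?_)
open import Data.Product using (_×_)
open import Relation.Nullary using (Dec; ¬_)
open import Relation.Nullary.Decidable using (_→-dec_; _×-dec_)
open import Relation.Binary.PropositionalEquality using (_≡_)
open import Function.Bundles using (_⇔_)

record Matroid (n : ℕ) : Set where
  field
    rk          : Subset n → ℕ
    rk-bounded  : ∀ A → rk A ≤ ∣ A ∣                              -- (R1) (0 ≤ rk A automatic in ℕ)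
    rk-monotone : ∀ {A B} → A ⊆ B → rk A ≤ rk B
    rk-submod   : ∀ A B → rk (A ∪ B) ℕ.+ rk (A ∩ B) ≤ rk A ℕ.+ rk B

open Matroid public

rank : ∀ {n} → Matroid n → ℕ
rank M = rk M ⊤

allSubsets : (n : ℕ) → List (Subset n)
allSubsets zero    = [] ∷ []
allSubsets (suc n) = map (true ∷_) (allSubsets n) ++ map (false ∷_) (allSubsets n)

IsFlat : ∀ {n} → Matroid n → Subset n → Set
IsFlat M F = ∀ e → (rk M (F ∪ ⁅ e ⁆) ≡ rk M F) ⇔ e ∈ F

IsHyperplane : ∀ {n} → Matroid n → Subset n → Set
IsHyperplane M F = IsFlat M F × (rk M F ℕ.+ 1 ≡ rank M)

private
  ⇔-dec : ∀ {P Q : Set} → Dec P → Dec Q → Dec (P ⇔ Q)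
  ⇔-dec p q = Relation.Nullary.Decidable.map′
                (λ { (f Data.Product., g) → Function.Bundles.mk⇔ f g })
                (λ e → Function.Bundles.Equivalence.to e Data.Product., Function.Bundles.Equivalence.from e)
                ((p →-dec q) ×-dec (q →-dec p))

isHyperplane? : ∀ {n} (M : Matroid n) (F : Subset n) → Dec (IsHyperplane M F)
isHyperplane? M F =
  all? (λ e → ⇔-dec (rk M (F ∪ ⁅ e ⁆) ℕ.≟ rk M F) (e ∈? F))
  ×-dec (rk M F ℕ.+ 1 ℕ.≟ rank M)

-- f₁(M) = max { |F| : F a hyperplane }  (computed by enumerating all subsets;
-- the empty maximum is 0, which only occurs when rank M = 0)
f1 : ∀ {n} → Matroid n → ℕ
f1 {n} M = foldr _⊔_ 0 (map ∣_∣ (filter (isHyperplane? M) (allSubsets n)))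

-- Polynomials as coefficient lists (entry i = coefficient of the i-th power)

module Poly (A : Set) (0# 1# : A) (_+_ _*_ : A → A → A) where
  P : Set
  P = List A

  _⊕_ : P → P → P
  []      ⊕ q       = q
  (a ∷ p) ⊕ []      = a ∷ p
  (a ∷ p) ⊕ (b ∷ q) = (a + b) ∷ (p ⊕ q)

  _⊗_ : P → P → P
  []      ⊗ q = []
  (a ∷ p) ⊗ q = map (a *_) q ⊕ (0# ∷ (p ⊗ q))

  _^^_ : P → ℕ → P
  p ^^ zero  = 1# ∷ []
  p ^^ suc k = p ⊗ (p ^^ k)

  Σ[_] : List P → P
  Σ[ ps ] = foldr _⊕_ [] ps

  eval : P → A → A
  eval []      x = 0#
  eval (a ∷ p) x = a + (x * eval p x)

  coeff : P → ℕ → A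
  coeff []      _       = 0#
  coeff (a ∷ p) zero    = a
  coeff (a ∷ p) (suc j) = coeff p j

module PZ = Poly ℤ (+ 0) (+ 1) ℤ._+_ ℤ._*_
-- (ℤ[y])[x] : outer variable x, coefficients in ℤ[y]
module PXY = Poly PZ.P [] (+ 1 ∷ []) PZ._⊕_ PZ._⊗_

x-1 : PXY.P
x-1 = (-[1+ 0 ] ∷ []) ∷ (+ 1 ∷ []) ∷ []

y-1 : PXY.P
y-1 = (-[1+ 0 ] ∷ + 1 ∷ []) ∷ []

tutte : ∀ {n} → Matroid n → PXY.P
tutte {n} M = PXY.Σ[ map term (allSubsets n) ]
  where
  term : Subset n → PXY.P
  term A = (x-1 PXY.^^ (rank M ∸ rk M A)) PXY.⊗ (y-1 PXY.^^ (∣ A ∣ ∸ rk M A))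

tutte1y : ∀ {n} → Matroid n → PZ.P
tutte1y M = PXY.eval (tutte M) (+ 1 ∷ [])

-- binomial coefficient with integer top, = 0 when the top is negative
binomℤ : ℤ → ℕ → ℤ
binomℤ (+ m)    k = + (m C k)
binomℤ -[1+ _ ] k = + 0

module Submission where

-- At x = 1 only the spanning sets survive in the Tutte polynomial, so [y^j] T_M(1,y) is the sum
-- of [y^j] (y-1)^(|A|-r) over spanning A.  The same sum over all A with |A| ≥ r is C(n-j-1, r-1)
-- (binomial theorem and Pascal's rule), hence the identity holds iff the corresponding sum S over
-- the non-spanning sets vanishes.  Deleting/contracting one element (a loop, a coloop, or neither)
-- gives recurrences for S showing that S is a natural number which is positive exactly when some
-- non-spanning set has at least r + j elements.  Every non-spanning set lies in a hyperplane, so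
-- this happens iff f₁(M) ≥ r + j.

open import Defs
open import Data.Nat as ℕ using (ℕ; zero; suc; _∸_; _≤_; _<_; z≤n; s≤s; s≤s⁻¹; _≤?_)
open import Data.Nat.Properties
open import Data.Nat.Combinatorics using (_C_; nCk+nC[k+1]≡[n+1]C[k+1]; k>n⇒nCk≡0)
open import Data.Integer as ℤ using (ℤ; +_; -[1+_]; _+_; _*_; -_) renaming (_-_ to _-ℤ_)
import Data.Integer.Properties as ℤ
open import Algebra.Properties.CommutativeSemigroup ℤ.+-commutativeSemigroup
  using () renaming (interchange to +-interchange)
open import Algebra.Bundles using (AbelianGroup)
open import Algebra.Properties.Group (AbelianGroup.group ℤ.+-0-abelianGroup)
  using () renaming (identityʳ-unique to +-identityʳ-unique)
open import Data.Integer.Solver using (module +-*-Solver)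
open +-*-Solver using (solve; _:=_; _:+_; _:-_; _:*_; :-_; con)
open import Data.List using (List; []; _∷_; map; foldr; filter; _++_; allFin)
import Data.List.Properties as List
open import Data.List.Properties using (foldr-preservesᵇ; foldr-preservesᵒ)
open import Data.Bool using (true; false)
open import Data.Vec using ([]; _∷_)
open import Data.Fin using (Fin; zero)
open import Data.Fin.Properties using (all?; ¬∀⟶∃¬)
open import Data.Fin.Subset using (Subset; ∣_∣; ⊤; ⊥; ⁅_⁆; _∪_; _∩_; _⊆_; _∈_)
open import Data.Fin.Subset.Properties
  using ( ∣⊥∣≡0; ∣⊤∣≡n; ∣p∣≤n; p⊆q⇒∣p∣≤∣q∣; ∣⁅x⁆∣≡1; s⊆s; out⊆; ⊆-refl; ⊆-min; ⊆⊤
        ; ∪-identityʳ; ∪-zeroˡ; ∩-identityˡ; p⊆p∪q; q⊆p∪q; x∈p∪q⁺; x∈p∪q⁻; x∈⁅x⁆; x∈⁅y⁆⇒x≡y; _∈?_)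
open import Data.List.Membership.Propositional using () renaming (_∈_ to _∈ₗ_)
open import Data.List.Membership.Propositional.Properties
  using (∈-allFin; ∈-map⁺; ∈-++⁺ˡ; ∈-++⁺ʳ; ∈-filter⁺)
open import Data.List.Relation.Unary.Any as Any using (here; there)
import Data.List.Relation.Unary.Any.Properties as Anyₚ
import Data.List.Relation.Unary.All as All
import Data.List.Relation.Unary.All.Properties as Allₚ
open import Data.Product using (∃; _×_; _,_; proj₂)
open import Data.Sum using (_⊎_; inj₁; inj₂; [_,_]; map₁)
open import Data.Sum.Function.Propositional using (_⊎-⇔_)
open import Function using (_∘_; id)
open import Function.Bundles using (_⇔_; mk⇔; Equivalence)
open import Function.Properties.Equivalence using () renaming (trans to ⇔-trans; sym to ⇔-sym)
open import Relation.Nullary using (¬_; yes; no; contradiction)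
open import Level using (0ℓ)
open import Relation.Binary.Bundles using (Setoid)
import Relation.Binary.Reasoning.Setoid
open import Relation.Binary.PropositionalEquality
  using (_≡_; refl; sym; trans; cong; cong₂; subst; subst₂; ≢-sym; module ≡-Reasoning)

open PZ using (coeff; _⊕_; _⊗_)
open PXY using () renaming (_⊕_ to _⊕ₓ_; _⊗_ to _⊗ₓ_; _^^_ to _^^ₓ_; Σ[_] to Σₓ[_])

infix 4 _≈_
record _≈_ (p q : PZ.P) : Set where
  constructor coeffwise
  field coeff-≡ : ∀ k → coeff p k ≡ coeff q k
open _≈_

≈-setoid : Setoid 0ℓ 0ℓ
≈-setoid = record
  { Carrier       = PZ.P
  ; _≈_           = _≈_
  ; isEquivalence = record
    { refl  = coeffwise λ _ → refl
    ; sym   = λ p≈q → coeffwise λ k → sym (p≈q .coeff-≡ k)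
    ; trans = λ p≈q q≈s → coeffwise λ k → trans (p≈q .coeff-≡ k) (q≈s .coeff-≡ k)
    }
  }

open Setoid ≈-setoid using () renaming (refl to ≈-refl; sym to ≈-sym; trans to ≈-trans)
module ≈-Reasoning = Relation.Binary.Reasoning.Setoid ≈-setoid

coeff-⊕ : ∀ p q k → coeff (p ⊕ q) k ≡ coeff p k + coeff q k
coeff-⊕ []      q       k       = sym (ℤ.+-identityˡ _)
coeff-⊕ (a ∷ p) []      k       = sym (ℤ.+-identityʳ _)
coeff-⊕ (a ∷ p) (b ∷ q) zero    = refl
coeff-⊕ (a ∷ p) (b ∷ q) (suc k) = coeff-⊕ p q k

⊕-cong : ∀ {p p′ q q′} → p ≈ p′ → q ≈ q′ → p ⊕ q ≈ p′ ⊕ q′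
⊕-cong {p} {p′} {q} {q′} p≈p′ q≈q′ .coeff-≡ k = begin
  coeff (p ⊕ q) k               ≡⟨ coeff-⊕ p q k ⟩
  coeff p k + coeff q k         ≡⟨ cong₂ _+_ (p≈p′ .coeff-≡ k) (q≈q′ .coeff-≡ k) ⟩
  coeff p′ k + coeff q′ k       ≡⟨ coeff-⊕ p′ q′ k ⟨
  coeff (p′ ⊕ q′) k             ∎
  where open ≡-Reasoning

coeff-scale : ∀ a q k → coeff (map (a *_) q) k ≡ a * coeff q k
coeff-scale a []      k       = sym (ℤ.*-zeroʳ a)
coeff-scale a (b ∷ q) zero    = refl
coeff-scale a (b ∷ q) (suc k) = coeff-scale a q k

coeff-∷⊗ : ∀ a p q k → coeff ((a ∷ p) ⊗ q) k ≡ a * coeff q k + coeff (+ 0 ∷ p ⊗ q) k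
coeff-∷⊗ a p q k = trans (coeff-⊕ (map (a *_) q) _ k) (cong (_+ _) (coeff-scale a q k))

⊗-zeroˡ : ∀ p q → p ≈ [] → p ⊗ q ≈ []
⊗-zeroˡ []      q p≈0 = ≈-refl
⊗-zeroˡ (a ∷ p) q p≈0 .coeff-≡ k = begin
  coeff ((a ∷ p) ⊗ q) k                 ≡⟨ coeff-∷⊗ a p q k ⟩
  a * coeff q k + coeff (+ 0 ∷ p ⊗ q) k
    ≡⟨ cong₂ _+_ (cong (_* coeff q k) (p≈0 .coeff-≡ 0)) (tail≈0 k) ⟩
  + 0                                   ∎
  where
  open ≡-Reasoning
  tail≈0 : ∀ k → coeff (+ 0 ∷ p ⊗ q) k ≡ + 0
  tail≈0 zero    = refl
  tail≈0 (suc k) = ⊗-zeroˡ p q (coeffwise (p≈0 .coeff-≡ ∘ suc)) .coeff-≡ k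

⊗-zeroʳ : ∀ p → p ⊗ [] ≈ []
⊗-zeroʳ []      = ≈-refl
⊗-zeroʳ (a ∷ p) .coeff-≡ k = trans (coeff-∷⊗ a p [] k) (cong₂ _+_ (ℤ.*-zeroʳ a) (tail≈0 k))
  where
  tail≈0 : ∀ k → coeff (+ 0 ∷ p ⊗ []) k ≡ + 0
  tail≈0 zero    = refl
  tail≈0 (suc k) = ⊗-zeroʳ p .coeff-≡ k

⊗-identityˡ : ∀ p → (+ 1 ∷ []) ⊗ p ≈ p
⊗-identityˡ p .coeff-≡ k = begin
  coeff ((+ 1 ∷ []) ⊗ p) k             ≡⟨ coeff-∷⊗ (+ 1) [] p k ⟩
  + 1 * coeff p k + coeff (+ 0 ∷ []) k ≡⟨ cong₂ _+_ (ℤ.*-identityˡ (coeff p k)) (tail≈0 k) ⟩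
  coeff p k + + 0                      ≡⟨ ℤ.+-identityʳ _ ⟩
  coeff p k                            ∎
  where
  open ≡-Reasoning
  tail≈0 : ∀ k → coeff (+ 0 ∷ []) k ≡ + 0
  tail≈0 zero    = refl
  tail≈0 (suc k) = refl

⊗-distribʳ-⊕ : ∀ p q s → (p ⊕ q) ⊗ s ≈ (p ⊗ s) ⊕ (q ⊗ s)
⊗-distribʳ-⊕ []      q       s = ≈-refl
⊗-distribʳ-⊕ (a ∷ p) []      s .coeff-≡ k =
  sym (trans (coeff-⊕ ((a ∷ p) ⊗ s) [] k) (ℤ.+-identityʳ _))
⊗-distribʳ-⊕ (a ∷ p) (b ∷ q) s .coeff-≡ k = begin
  coeff (((a + b) ∷ p ⊕ q) ⊗ s) k
    ≡⟨ coeff-∷⊗ (a + b) (p ⊕ q) s k ⟩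
  (a + b) * coeff s k + coeff (+ 0 ∷ (p ⊕ q) ⊗ s) k
    ≡⟨ cong (λ t → (a + b) * coeff s k + t) (tail k) ⟩
  (a + b) * coeff s k + (coeff (+ 0 ∷ p ⊗ s) k + coeff (+ 0 ∷ q ⊗ s) k)
    ≡⟨ rearrange a b (coeff s k) _ _ ⟩
  (a * coeff s k + coeff (+ 0 ∷ p ⊗ s) k) + (b * coeff s k + coeff (+ 0 ∷ q ⊗ s) k)
    ≡⟨ cong₂ _+_ (coeff-∷⊗ a p s k) (coeff-∷⊗ b q s k) ⟨
  coeff ((a ∷ p) ⊗ s) k + coeff ((b ∷ q) ⊗ s) k
    ≡⟨ coeff-⊕ ((a ∷ p) ⊗ s) _ k ⟨
  coeff (((a ∷ p) ⊗ s) ⊕ ((b ∷ q) ⊗ s)) k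
    ∎
  where
  open ≡-Reasoning
  tail : ∀ k → coeff (+ 0 ∷ (p ⊕ q) ⊗ s) k ≡ coeff (+ 0 ∷ p ⊗ s) k + coeff (+ 0 ∷ q ⊗ s) k
  tail zero    = refl
  tail (suc k) = trans (⊗-distribʳ-⊕ p q s .coeff-≡ k) (coeff-⊕ (p ⊗ s) _ k)
  rearrange : ∀ x y u v w → (x + y) * u + (v + w) ≡ (x * u + v) + (y * u + w)
  rearrange = solve 5 (λ x y u v w → (x :+ y) :* u :+ (v :+ w) := (x :* u :+ v) :+ (y :* u :+ w)) refl

⊗-distribˡ-⊕ : ∀ p q s → p ⊗ (q ⊕ s) ≈ (p ⊗ q) ⊕ (p ⊗ s)
⊗-distribˡ-⊕ []      q s = ≈-refl
⊗-distribˡ-⊕ (a ∷ p) q s .coeff-≡ k = begin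
  coeff ((a ∷ p) ⊗ (q ⊕ s)) k
    ≡⟨ coeff-∷⊗ a p (q ⊕ s) k ⟩
  a * coeff (q ⊕ s) k + coeff (+ 0 ∷ p ⊗ (q ⊕ s)) k
    ≡⟨ cong₂ _+_ (cong (a *_) (coeff-⊕ q s k)) (tail k) ⟩
  a * (coeff q k + coeff s k) + (coeff (+ 0 ∷ p ⊗ q) k + coeff (+ 0 ∷ p ⊗ s) k)
    ≡⟨ rearrange a (coeff q k) (coeff s k) _ _ ⟩
  (a * coeff q k + coeff (+ 0 ∷ p ⊗ q) k) + (a * coeff s k + coeff (+ 0 ∷ p ⊗ s) k)
    ≡⟨ cong₂ _+_ (coeff-∷⊗ a p q k) (coeff-∷⊗ a p s k) ⟨
  coeff ((a ∷ p) ⊗ q) k + coeff ((a ∷ p) ⊗ s) k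
    ≡⟨ coeff-⊕ ((a ∷ p) ⊗ q) _ k ⟨
  coeff (((a ∷ p) ⊗ q) ⊕ ((a ∷ p) ⊗ s)) k
    ∎
  where
  open ≡-Reasoning
  tail : ∀ k → coeff (+ 0 ∷ p ⊗ (q ⊕ s)) k ≡ coeff (+ 0 ∷ p ⊗ q) k + coeff (+ 0 ∷ p ⊗ s) k
  tail zero    = refl
  tail (suc k) = trans (⊗-distribˡ-⊕ p q s .coeff-≡ k) (coeff-⊕ (p ⊗ q) _ k)
  rearrange : ∀ x u v w z → x * (u + v) + (w + z) ≡ (x * u + w) + (x * v + z)
  rearrange = solve 5 (λ x u v w z → x :* (u :+ v) :+ (w :+ z) := (x :* u :+ w) :+ (x :* v :+ z)) refl

y-1ᶻ : PZ.P
y-1ᶻ = -[1+ 0 ] ∷ + 1 ∷ []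

coeff-y-1⊗ : ∀ p k → coeff (y-1ᶻ ⊗ p) k ≡ - coeff p k + coeff (+ 0 ∷ p) k
coeff-y-1⊗ p k =
  trans (coeff-∷⊗ -[1+ 0 ] (+ 1 ∷ []) p k) (cong₂ _+_ (ℤ.-1*i≡-i (coeff p k)) (tail k))
  where
  tail : ∀ k → coeff (+ 0 ∷ (+ 1 ∷ []) ⊗ p) k ≡ coeff (+ 0 ∷ p) k
  tail zero    = refl
  tail (suc k) = ⊗-identityˡ p .coeff-≡ k

sumCoeffs : PXY.P → PZ.P
sumCoeffs = foldr _⊕_ []

eval-one≈sumCoeffs : ∀ P → PXY.eval P (+ 1 ∷ []) ≈ sumCoeffs P
eval-one≈sumCoeffs []      = ≈-refl
eval-one≈sumCoeffs (a ∷ P) =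
  ⊕-cong ≈-refl (≈-trans (⊗-identityˡ (PXY.eval P (+ 1 ∷ []))) (eval-one≈sumCoeffs P))

sumCoeffs-⊕ : ∀ P Q → sumCoeffs (P ⊕ₓ Q) ≈ sumCoeffs P ⊕ sumCoeffs Q
sumCoeffs-⊕ []      Q       = ≈-refl
sumCoeffs-⊕ (a ∷ P) []      .coeff-≡ k =
  sym (trans (coeff-⊕ (sumCoeffs (a ∷ P)) [] k) (ℤ.+-identityʳ _))
sumCoeffs-⊕ (a ∷ P) (b ∷ Q) .coeff-≡ k = begin
  coeff ((a ⊕ b) ⊕ sumCoeffs (P ⊕ₓ Q)) k
    ≡⟨ trans (coeff-⊕ (a ⊕ b) _ k) (cong₂ _+_ (coeff-⊕ a b k) (sumCoeffs-⊕ P Q .coeff-≡ k)) ⟩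
  (coeff a k + coeff b k) + coeff (sumCoeffs P ⊕ sumCoeffs Q) k
    ≡⟨ cong (λ t → (coeff a k + coeff b k) + t) (coeff-⊕ (sumCoeffs P) _ k) ⟩
  (coeff a k + coeff b k) + (coeff (sumCoeffs P) k + coeff (sumCoeffs Q) k)
    ≡⟨ +-interchange (coeff a k) _ _ _ ⟩
  (coeff a k + coeff (sumCoeffs P) k) + (coeff b k + coeff (sumCoeffs Q) k)
    ≡⟨ trans (coeff-⊕ (a ⊕ sumCoeffs P) _ k) (cong₂ _+_ (coeff-⊕ a _ k) (coeff-⊕ b _ k)) ⟨
  coeff ((a ⊕ sumCoeffs P) ⊕ (b ⊕ sumCoeffs Q)) k
    ∎
  where open ≡-Reasoning

sumCoeffs-scale : ∀ a Q → sumCoeffs (map (a ⊗_) Q) ≈ a ⊗ sumCoeffs Q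
sumCoeffs-scale a []      = ≈-sym (⊗-zeroʳ a)
sumCoeffs-scale a (l ∷ Q) =
  ≈-trans (⊕-cong ≈-refl (sumCoeffs-scale a Q)) (≈-sym (⊗-distribˡ-⊕ a l _))

sumCoeffs-⊗ : ∀ P Q → sumCoeffs (P ⊗ₓ Q) ≈ sumCoeffs P ⊗ sumCoeffs Q
sumCoeffs-⊗ []      Q = ≈-refl
sumCoeffs-⊗ (a ∷ P) Q = begin
  sumCoeffs (map (a ⊗_) Q ⊕ₓ ([] ∷ P ⊗ₓ Q))
    ≈⟨ sumCoeffs-⊕ (map (a ⊗_) Q) _ ⟩
  sumCoeffs (map (a ⊗_) Q) ⊕ sumCoeffs (P ⊗ₓ Q)
    ≈⟨ ⊕-cong (sumCoeffs-scale a Q) (sumCoeffs-⊗ P Q) ⟩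
  (a ⊗ sumCoeffs Q) ⊕ (sumCoeffs P ⊗ sumCoeffs Q)
    ≈⟨ ⊗-distribʳ-⊕ a (sumCoeffs P) _ ⟨
  (a ⊕ sumCoeffs P) ⊗ sumCoeffs Q
    ∎
  where open ≈-Reasoning

-m+n+m≡n : ∀ m n → (- m + n) + m ≡ n
-m+n+m≡n = solve 2 (λ m n → (:- m :+ n) :+ m := n) refl

powCoeff : ℕ → ℕ → ℤ
powCoeff zero    zero    = + 1
powCoeff zero    (suc k) = + 0
powCoeff (suc b) zero    = - powCoeff b zero
powCoeff (suc b) (suc k) = - powCoeff b (suc k) + powCoeff b k

sumCoeffs-y-1^^ : ∀ b k → coeff (sumCoeffs (y-1 ^^ₓ b)) k ≡ powCoeff b k
sumCoeffs-y-1^^ zero    zero    = refl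
sumCoeffs-y-1^^ zero    (suc k) = refl
sumCoeffs-y-1^^ (suc b) k = begin
  coeff (sumCoeffs (y-1 ⊗ₓ (y-1 ^^ₓ b))) k         ≡⟨ sumCoeffs-⊗ y-1 (y-1 ^^ₓ b) .coeff-≡ k ⟩
  coeff (y-1ᶻ ⊗ Y) k                               ≡⟨ coeff-y-1⊗ Y k ⟩
  - coeff Y k + coeff (+ 0 ∷ Y) k                  ≡⟨ step k ⟩
  powCoeff (suc b) k                               ∎
  where
  open ≡-Reasoning
  Y : PZ.P
  Y = sumCoeffs (y-1 ^^ₓ b)
  step : ∀ k → - coeff Y k + coeff (+ 0 ∷ Y) k ≡ powCoeff (suc b) k
  step zero    = trans (ℤ.+-identityʳ _) (cong -_ (sumCoeffs-y-1^^ b zero))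
  step (suc k) = cong₂ (λ u v → - u + v) (sumCoeffs-y-1^^ b (suc k)) (sumCoeffs-y-1^^ b k)

termCoeff : ℕ → ℕ → ℕ → ℤ
termCoeff zero    b k = powCoeff b k
termCoeff (suc a) b k = + 0

sumCoeffs-x-1^^ : ∀ a → sumCoeffs (x-1 ^^ₓ suc a) ≈ []
sumCoeffs-x-1^^ a = ≈-trans (sumCoeffs-⊗ x-1 (x-1 ^^ₓ a)) (⊗-zeroˡ (sumCoeffs x-1) _ x-1≈0)
  where
  x-1≈0 : sumCoeffs x-1 ≈ []
  x-1≈0 .coeff-≡ zero    = refl
  x-1≈0 .coeff-≡ (suc k) = refl

sumCoeffs-term : ∀ a b k → coeff (sumCoeffs ((x-1 ^^ₓ a) ⊗ₓ (y-1 ^^ₓ b))) k ≡ termCoeff a b k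
sumCoeffs-term zero    b k = begin
  coeff (sumCoeffs ((x-1 ^^ₓ 0) ⊗ₓ (y-1 ^^ₓ b))) k   ≡⟨ sumCoeffs-⊗ (x-1 ^^ₓ 0) (y-1 ^^ₓ b) .coeff-≡ k ⟩
  coeff ((+ 1 ∷ []) ⊗ sumCoeffs (y-1 ^^ₓ b)) k       ≡⟨ ⊗-identityˡ (sumCoeffs (y-1 ^^ₓ b)) .coeff-≡ k ⟩
  coeff (sumCoeffs (y-1 ^^ₓ b)) k                    ≡⟨ sumCoeffs-y-1^^ b k ⟩
  powCoeff b k                                       ∎
  where open ≡-Reasoning
sumCoeffs-term (suc a) b k =
  ≈-trans (sumCoeffs-⊗ (x-1 ^^ₓ suc a) (y-1 ^^ₓ b)) (⊗-zeroˡ _ _ (sumCoeffs-x-1^^ a)) .coeff-≡ k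

sumℤ : List ℤ → ℤ
sumℤ = foldr _+_ (+ 0)

sumℤ-++ : ∀ xs ys → sumℤ (xs ++ ys) ≡ sumℤ xs + sumℤ ys
sumℤ-++ []       ys = sym (ℤ.+-identityˡ _)
sumℤ-++ (x ∷ xs) ys = trans (cong (_+_ x) (sumℤ-++ xs ys)) (sym (ℤ.+-assoc x _ _))

coeff-sumCoeffs-Σ : ∀ Ps k →
  coeff (sumCoeffs Σₓ[ Ps ]) k ≡ sumℤ (map (λ P → coeff (sumCoeffs P) k) Ps)
coeff-sumCoeffs-Σ []       k = refl
coeff-sumCoeffs-Σ (P ∷ Ps) k =
  trans (sumCoeffs-⊕ P Σₓ[ Ps ] .coeff-≡ k)
    (trans (coeff-⊕ (sumCoeffs P) _ k) (cong (_+_ (coeff (sumCoeffs P) k)) (coeff-sumCoeffs-Σ Ps k)))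

sumSubsets : ∀ n → (Subset n → ℤ) → ℤ
sumSubsets zero    f = f []
sumSubsets (suc n) f = sumSubsets n (f ∘ (true ∷_)) + sumSubsets n (f ∘ (false ∷_))

sumSubsets-cong : ∀ n {f g : Subset n → ℤ} →
                  (∀ A → f A ≡ g A) → sumSubsets n f ≡ sumSubsets n g
sumSubsets-cong zero    f≗g = f≗g []
sumSubsets-cong (suc n) f≗g =
  cong₂ _+_ (sumSubsets-cong n (f≗g ∘ (true ∷_))) (sumSubsets-cong n (f≗g ∘ (false ∷_)))

sumSubsets-+ : ∀ n (f g : Subset n → ℤ) →
               sumSubsets n (λ A → f A + g A) ≡ sumSubsets n f + sumSubsets n g
sumSubsets-+ zero    f g = refl
sumSubsets-+ (suc n) f g =
  trans (cong₂ _+_ (sumSubsets-+ n (f ∘ (true ∷_)) _) (sumSubsets-+ n (f ∘ (false ∷_)) _))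
        (+-interchange (sumSubsets n (f ∘ (true ∷_))) _ _ _)

sumSubsets-neg : ∀ n (f : Subset n → ℤ) → sumSubsets n (λ A → - f A) ≡ - sumSubsets n f
sumSubsets-neg zero    f = refl
sumSubsets-neg (suc n) f =
  trans (cong₂ _+_ (sumSubsets-neg n (f ∘ (true ∷_))) (sumSubsets-neg n (f ∘ (false ∷_))))
        (sym (ℤ.neg-distrib-+ (sumSubsets n (f ∘ (true ∷_))) _))

sumℤ-allSubsets : ∀ n (f : Subset n → ℤ) → sumℤ (map f (allSubsets n)) ≡ sumSubsets n f
sumℤ-allSubsets zero    f = ℤ.+-identityʳ (f [])
sumℤ-allSubsets (suc n) f = begin
  sumℤ (map f (map (true ∷_) L ++ map (false ∷_) L))
    ≡⟨ cong sumℤ (List.map-++ f (map (true ∷_) L) _) ⟩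
  sumℤ (map f (map (true ∷_) L) ++ map f (map (false ∷_) L))
    ≡⟨ sumℤ-++ (map f (map (true ∷_) L)) _ ⟩
  sumℤ (map f (map (true ∷_) L)) + sumℤ (map f (map (false ∷_) L))
    ≡⟨ cong₂ _+_ (cong sumℤ (List.map-∘ L)) (cong sumℤ (List.map-∘ L)) ⟨
  sumℤ (map (f ∘ (true ∷_)) L) + sumℤ (map (f ∘ (false ∷_)) L)
    ≡⟨ cong₂ _+_ (sumℤ-allSubsets n _) (sumℤ-allSubsets n _) ⟩
  sumSubsets (suc n) f
    ∎
  where
  open ≡-Reasoning
  L : List (Subset n)
  L = allSubsets n

coeff-tutte1y : ∀ {n} (M : Matroid n) j →
  coeff (tutte1y M) j ≡ sumSubsets n (λ A → termCoeff (rank M ∸ rk M A) (∣ A ∣ ∸ rk M A) j)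
coeff-tutte1y {n} M j = begin
  coeff (tutte1y M) j
    ≡⟨ eval-one≈sumCoeffs (tutte M) .coeff-≡ j ⟩
  coeff (sumCoeffs Σₓ[ map term (allSubsets n) ]) j
    ≡⟨ coeff-sumCoeffs-Σ (map term (allSubsets n)) j ⟩
  sumℤ (map (λ P → coeff (sumCoeffs P) j) (map term (allSubsets n)))
    ≡⟨ cong sumℤ (List.map-∘ (allSubsets n)) ⟨
  sumℤ (map (λ A → coeff (sumCoeffs (term A)) j) (allSubsets n))
    ≡⟨ sumℤ-allSubsets n _ ⟩
  sumSubsets n (λ A → coeff (sumCoeffs (term A)) j)
    ≡⟨ sumSubsets-cong n (λ A → sumCoeffs-term (rank M ∸ rk M A) (∣ A ∣ ∸ rk M A) j) ⟩
  sumSubsets n (λ A → termCoeff (rank M ∸ rk M A) (∣ A ∣ ∸ rk M A) j)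
    ∎
  where
  open ≡-Reasoning
  term : Subset n → PXY.P
  term A = (x-1 ^^ₓ (rank M ∸ rk M A)) ⊗ₓ (y-1 ^^ₓ (∣ A ∣ ∸ rk M A))

δ : ℕ → ℕ → ℤ
δ zero    zero    = + 1
δ zero    (suc n) = + 0
δ (suc m) zero    = + 0
δ (suc m) (suc n) = δ m n

sumSubsets-powCoeff : ∀ n j → sumSubsets n (λ A → powCoeff ∣ A ∣ j) ≡ δ n j
sumSubsets-powCoeff zero    zero    = refl
sumSubsets-powCoeff zero    (suc j) = refl
sumSubsets-powCoeff (suc n) zero    =
  trans (cong (_+ S) (sumSubsets-neg n (λ A → powCoeff ∣ A ∣ 0))) (ℤ.+-inverseˡ S)
  where
  S : ℤ
  S = sumSubsets n (λ A → powCoeff ∣ A ∣ 0)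
sumSubsets-powCoeff (suc n) (suc j) = begin
  sumSubsets n (λ A → - powCoeff (∣ A ∣) (suc j) + powCoeff (∣ A ∣) j) + S
    ≡⟨ cong (_+ S) (sumSubsets-+ n (λ A → - powCoeff ∣ A ∣ (suc j)) _) ⟩
  (sumSubsets n (λ A → - powCoeff (∣ A ∣) (suc j)) + sumSubsets n (λ A → powCoeff ∣ A ∣ j)) + S
    ≡⟨ cong (λ t → (t + sumSubsets n (λ A → powCoeff ∣ A ∣ j)) + S)
            (sumSubsets-neg n (λ A → powCoeff ∣ A ∣ (suc j))) ⟩
  (- S + sumSubsets n (λ A → powCoeff ∣ A ∣ j)) + S
    ≡⟨ -m+n+m≡n S _ ⟩
  sumSubsets n (λ A → powCoeff ∣ A ∣ j)
    ≡⟨ sumSubsets-powCoeff n j ⟩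
  δ n j
    ∎
  where
  open ≡-Reasoning
  S : ℤ
  S = sumSubsets n (λ A → powCoeff ∣ A ∣ (suc j))

spanningCoeff : ℕ → ℕ → ℕ → ℤ
spanningCoeff zero    k s       = powCoeff s k
spanningCoeff (suc r) k zero    = + 0
spanningCoeff (suc r) k (suc s) = spanningCoeff r k s

spanningCoeff-≤ : ∀ {r s} k → r ≤ s → spanningCoeff r k s ≡ powCoeff (s ∸ r) k
spanningCoeff-≤ k z≤n       = refl
spanningCoeff-≤ k (s≤s r≤s) = spanningCoeff-≤ k r≤s

-- (y - 1)^(m + 1) + (y - 1)^m = y (y - 1)^m
spanningCoeff-pascal : ∀ r k s →
  spanningCoeff r (suc k) (suc s) + spanningCoeff r (suc k) s ≡ spanningCoeff r k s
spanningCoeff-pascal zero    k s       = -m+n+m≡n (powCoeff s (suc k)) (powCoeff s k)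
spanningCoeff-pascal (suc r) k zero    = trans (ℤ.+-identityʳ _) (below r)
  where
  below : ∀ r → spanningCoeff r (suc k) 0 ≡ + 0
  below zero    = refl
  below (suc r) = refl
spanningCoeff-pascal (suc r) k (suc s) = spanningCoeff-pascal r k s

spanningCoeff-pascal₀ : ∀ r s → spanningCoeff r 0 (suc s) + spanningCoeff r 0 s ≡ δ r (suc s)
spanningCoeff-pascal₀ zero          s       = ℤ.+-inverseˡ (powCoeff s 0)
spanningCoeff-pascal₀ (suc zero)    zero    = refl
spanningCoeff-pascal₀ (suc (suc r)) zero    = refl
spanningCoeff-pascal₀ (suc r)       (suc s) = spanningCoeff-pascal₀ r s

binom∸ : ℕ → ℕ → ℕ → ℕ
binom∸ zero    j       r = 0
binom∸ (suc n) zero    r = n C r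
binom∸ (suc n) (suc j) r = binom∸ n j r

binomℤ≡binom∸ : ∀ n j r → binomℤ (+ n -ℤ + j -ℤ + 1) r ≡ + binom∸ n j r
binomℤ≡binom∸ zero    zero    r = refl
binomℤ≡binom∸ zero    (suc j) r = refl
binomℤ≡binom∸ (suc n) zero    r = cong (λ z → binomℤ z r) (top (+ n))
  where
  top : ∀ x → (+ 1 + x) -ℤ + 0 -ℤ + 1 ≡ x
  top = solve 1 (λ x → (con (+ 1) :+ x) :- con (+ 0) :- con (+ 1) := x) refl
binomℤ≡binom∸ (suc n) (suc j) r = trans (cong (λ z → binomℤ z r) top) (binomℤ≡binom∸ n j r)
  where
  top : + suc n -ℤ + suc j -ℤ + 1 ≡ + n -ℤ + j -ℤ + 1
  top = cong (_-ℤ + 1) (trans (ℤ.m-n≡m⊖n (suc n) (suc j))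
                      (trans (ℤ.[1+m]⊖[1+n]≡m⊖n n j) (sym (ℤ.m-n≡m⊖n n j))))

δ+binom∸ : ∀ n j → δ n j + + binom∸ n j 0 ≡ + binom∸ (suc n) j 0
δ+binom∸ zero    zero    = refl
δ+binom∸ zero    (suc j) = refl
δ+binom∸ (suc n) zero    = refl
δ+binom∸ (suc n) (suc j) = δ+binom∸ n j

binom∸-pascal : ∀ n j r → binom∸ n j r ℕ.+ binom∸ n j (suc r) ≡ binom∸ (suc n) j (suc r)
binom∸-pascal zero    zero    r = refl
binom∸-pascal zero    (suc j) r = refl
binom∸-pascal (suc n) zero    r = nCk+nC[k+1]≡[n+1]C[k+1] n r
binom∸-pascal (suc n) (suc j) r = binom∸-pascal n j r

sumSubsets-spanningCoeff : ∀ n r j →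
  sumSubsets n (λ A → spanningCoeff (suc r) j ∣ A ∣) ≡ + binom∸ n j r
sumSubsets-spanningCoeff zero    r       j = refl
sumSubsets-spanningCoeff (suc n) zero    j =
  trans (cong₂ _+_ (sumSubsets-powCoeff n j) (sumSubsets-spanningCoeff n zero j)) (δ+binom∸ n j)
sumSubsets-spanningCoeff (suc n) (suc r) j =
  trans (cong₂ _+_ (sumSubsets-spanningCoeff n r j) (sumSubsets-spanningCoeff n (suc r) j))
        (cong +_ (binom∸-pascal n j r))

PositiveIff : ℤ → Set → Set
PositiveIff s B = ∃ λ m → s ≡ + m × (0 < m ⇔ B)

PositiveIff-resp : ∀ {s t B C} → s ≡ t → B ⇔ C → PositiveIff s B → PositiveIff t C
PositiveIff-resp s≡t B⇔C (m , s≡m , m>0⇔B) = m , trans (sym s≡t) s≡m , ⇔-trans m>0⇔B B⇔C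

PositiveIff⇒≡0⇔¬ : ∀ {s B} → PositiveIff s B → s ≡ + 0 ⇔ (¬ B)
PositiveIff⇒≡0⇔¬ {s} (m , s≡m , m>0⇔B) = mk⇔ to from
  where
  to : s ≡ + 0 → ¬ _
  to s≡0 b = <⇒≢ (Equivalence.from m>0⇔B b) (ℤ.+-injective (trans (sym s≡0) s≡m))
  from : ¬ _ → s ≡ + 0
  from ¬b = trans s≡m (cong +_ (n≤0⇒n≡0 (≮⇒≥ (¬b ∘ Equivalence.to m>0⇔B))))

+-positive⇔ : ∀ m k → 0 < m ℕ.+ k ⇔ (0 < m ⊎ 0 < k)
+-positive⇔ m k =
  mk⇔ (to m) [ (λ m>0 → ≤-trans m>0 (m≤m+n m k)) , (λ k>0 → ≤-trans k>0 (m≤n+m k m)) ]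
  where
  to : ∀ m → 0 < m ℕ.+ k → 0 < m ⊎ 0 < k
  to zero    k>0 = inj₂ k>0
  to (suc m) _   = inj₁ (s≤s z≤n)

PositiveIff-+ : ∀ {s t B C} → PositiveIff s B → PositiveIff t C → PositiveIff (s + t) (B ⊎ C)
PositiveIff-+ (m , s≡m , m>0⇔B) (k , t≡k , k>0⇔C) =
  m ℕ.+ k , cong₂ _+_ s≡m t≡k , ⇔-trans (+-positive⇔ m k) (m>0⇔B ⊎-⇔ k>0⇔C)

PositiveIff-sumSubsets : ∀ n {f : Subset n → ℤ} {B : Subset n → Set} →
                         (∀ A → PositiveIff (f A) (B A)) → PositiveIff (sumSubsets n f) (∃ B)
PositiveIff-sumSubsets zero    f≈B = PositiveIff-resp refl (mk⇔ ([] ,_) λ { ([] , b) → b }) (f≈B [])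
PositiveIff-sumSubsets (suc n) f≈B =
  PositiveIff-resp refl (mk⇔ join split)
    (PositiveIff-+ (PositiveIff-sumSubsets n (f≈B ∘ (true ∷_)))
                   (PositiveIff-sumSubsets n (f≈B ∘ (false ∷_))))
  where
  join : _ ⊎ _ → ∃ _
  join (inj₁ (A , b)) = true ∷ A , b
  join (inj₂ (A , b)) = false ∷ A , b
  split : ∃ _ → _ ⊎ _
  split (true  ∷ A , b) = inj₁ (A , b)
  split (false ∷ A , b) = inj₂ (A , b)

PositiveIff-δ : ∀ m n → PositiveIff (δ m n) (m ≡ n)
PositiveIff-δ zero    zero    = 1 , refl , mk⇔ (λ _ → refl) (λ _ → s≤s z≤n)
PositiveIff-δ zero    (suc n) = 0 , refl , mk⇔ (λ ()) (λ ())
PositiveIff-δ (suc m) zero    = 0 , refl , mk⇔ (λ ()) (λ ())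
PositiveIff-δ (suc m) (suc n) = PositiveIff-resp refl (mk⇔ (cong suc) suc-injective) (PositiveIff-δ m n)

0<nCk⇔k≤n : ∀ n k → 0 < n C k ⇔ k ≤ n
0<nCk⇔k≤n n k = mk⇔ to (from n k)
  where
  to : 0 < n C k → k ≤ n
  to nCk>0 with k ≤? n
  ... | yes k≤n = k≤n
  ... | no  k≰n = contradiction (k>n⇒nCk≡0 (≰⇒> k≰n)) (≢-sym (<⇒≢ nCk>0))
  from : ∀ n k → k ≤ n → 0 < n C k
  from n       zero    _         = s≤s z≤n
  from (suc n) (suc k) (s≤s k≤n) =
    subst (0 <_) (nCk+nC[k+1]≡[n+1]C[k+1] n k) (≤-trans (from n k k≤n) (m≤m+n _ _))

PositiveIff-binom∸ : ∀ n j d → PositiveIff (+ binom∸ n j d) (suc d ℕ.+ j ≤ n)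
PositiveIff-binom∸ zero    j       d = 0 , refl , mk⇔ (λ ()) (λ ())
PositiveIff-binom∸ (suc n) zero    d =
  n C d , refl , ⇔-trans (0<nCk⇔k≤n n d) (mk⇔ (s≤s ∘ subst (_≤ n) (sym (+-identityʳ d)))
                                               (subst (_≤ n) (+-identityʳ d) ∘ s≤s⁻¹))
PositiveIff-binom∸ (suc n) (suc j) d =
  PositiveIff-resp refl (mk⇔ (subst (_≤ suc n) (sym (+-suc (suc d) j)) ∘ s≤s)
                              (s≤s⁻¹ ∘ subst (_≤ suc n) (+-suc (suc d) j)))
                   (PositiveIff-binom∸ n j d)

[_<_]*_ : ℕ → ℕ → ℤ → ℤ
[ x     < zero  ]* v = + 0
[ zero  < suc r ]* v = v
[ suc x < suc r ]* v = [ x < r ]* v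

[<]*-< : ∀ {x r} v → x < r → [ x < r ]* v ≡ v
[<]*-< {zero}  {suc r} v _         = refl
[<]*-< {suc x} {suc r} v (s≤s x<r) = [<]*-< v x<r

[<]*-≥ : ∀ {x r} v → r ≤ x → [ x < r ]* v ≡ + 0
[<]*-≥ {x}     {zero}  v _         = refl
[<]*-≥ {suc x} {suc r} v (s≤s r≤x) = [<]*-≥ v r≤x

[<]*-+ : ∀ x r u v → [ x < r ]* (u + v) ≡ [ x < r ]* u + [ x < r ]* v
[<]*-+ x       zero    u v = refl
[<]*-+ zero    (suc r) u v = refl
[<]*-+ (suc x) (suc r) u v = [<]*-+ x r u v

PositiveIff-[<]* : ∀ {v B} x r → PositiveIff v B → PositiveIff ([ x < r ]* v) (x < r × B)
PositiveIff-[<]* x r v≈B with x <? r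
... | yes x<r = PositiveIff-resp (sym ([<]*-< _ x<r)) (mk⇔ (x<r ,_) proj₂) v≈B
... | no  x≮r = 0 , [<]*-≥ _ (≮⇒≥ x≮r) , mk⇔ (λ ()) (λ (x<r , _) → contradiction x<r x≮r)

nonspanningSum : ∀ n → (Subset n → ℕ) → ℕ → ℕ → ℤ
nonspanningSum n ρ r j = sumSubsets n (λ A → [ ρ A < r ]* spanningCoeff r j ∣ A ∣)

LargeNonspanning : ∀ {n} → (Subset n → ℕ) → ℕ → ℕ → Set
LargeNonspanning ρ r j = ∃ λ A → ρ A < r × r ℕ.+ j ≤ ∣ A ∣

NonspanningCriterion : ∀ n → (Subset n → ℕ) → ℕ → ℕ → Set
NonspanningCriterion n ρ r j = PositiveIff (nonspanningSum n ρ r j) (LargeNonspanning ρ r j)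

nonspanningCriterion-empty : ∀ ρ j → NonspanningCriterion 0 ρ 0 j
nonspanningCriterion-empty ρ j = 0 , refl , mk⇔ (λ ()) (λ { (_ , () , _) })

subsetOfSize : ∀ {n k} → k ≤ n → ∃ λ (A : Subset n) → ∣ A ∣ ≡ k
subsetOfSize {n} z≤n         = ⊥ , ∣⊥∣≡0 n
subsetOfSize     (s≤s k≤n) with subsetOfSize k≤n
... | A , ∣A∣≡k = true ∷ A , cong suc ∣A∣≡k

module _ {n} (ρ : Subset (suc n) → ℕ) where

  private
    ρ₀ ρ₁ : Subset n → ℕ
    ρ₀ = ρ ∘ (false ∷_)
    ρ₁ = ρ ∘ (true ∷_)

  nonspanningCriterion-coloop : ∀ d j → (∀ A → ρ₁ A ≡ suc (ρ₀ A)) → (∀ A → ρ₀ A ≤ d) →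
    NonspanningCriterion n ρ₀ d j → NonspanningCriterion (suc n) ρ (suc d) j
  nonspanningCriterion-coloop d j coloop ρ₀≤d criterion =
    PositiveIff-resp (cong₂ _+_ sum-with-0 sum-without-0) (mk⇔ to from)
      (PositiveIff-+ criterion (PositiveIff-binom∸ n j d))
    where
    sum-with-0 : nonspanningSum n ρ₀ d j ≡
                 sumSubsets n (λ A → [ ρ₁ A < suc d ]* spanningCoeff d j ∣ A ∣)
    sum-with-0 = sumSubsets-cong n (λ A → cong (λ x → [ x < suc d ]* _) (sym (coloop A)))
    sum-without-0 : + binom∸ n j d ≡
                    sumSubsets n (λ A → [ ρ₀ A < suc d ]* spanningCoeff (suc d) j ∣ A ∣)
    sum-without-0 = trans (sym (sumSubsets-spanningCoeff n d j))
                          (sumSubsets-cong n (λ A → sym ([<]*-< _ (s≤s (ρ₀≤d A)))))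
    to : LargeNonspanning ρ₀ d j ⊎ suc d ℕ.+ j ≤ n → LargeNonspanning ρ (suc d) j
    to (inj₁ (A , ρ₀A<d , large)) =
      true ∷ A , subst (_< suc d) (sym (coloop A)) (s≤s ρ₀A<d) , s≤s large
    to (inj₂ large) =
      false ∷ ⊤ , s≤s (ρ₀≤d ⊤) , subst (suc d ℕ.+ j ≤_) (sym (∣⊤∣≡n n)) large
    from : LargeNonspanning ρ (suc d) j → LargeNonspanning ρ₀ d j ⊎ suc d ℕ.+ j ≤ n
    from (true  ∷ A , ρ₁A<1+d , s≤s large) =
      inj₁ (A , s≤s⁻¹ (subst (_< suc d) (coloop A) ρ₁A<1+d) , large)
    from (false ∷ A , _ , large) = inj₂ (≤-trans large (∣p∣≤n A))

  nonspanningSum-loop : ∀ r k → (∀ A → ρ₁ A ≡ ρ₀ A) → nonspanningSum (suc n) ρ r k ≡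
    sumSubsets n (λ A → [ ρ₀ A < r ]* (spanningCoeff r k (suc ∣ A ∣) + spanningCoeff r k ∣ A ∣))
  nonspanningSum-loop r k loop = begin
    sumSubsets n (λ A → [ ρ₁ A < r ]* spanningCoeff r k (suc ∣ A ∣)) + nonspanningSum n ρ₀ r k
      ≡⟨ cong (_+ nonspanningSum n ρ₀ r k)
              (sumSubsets-cong n (λ A → cong (λ x → [ x < r ]* _) (loop A))) ⟩
    sumSubsets n (λ A → [ ρ₀ A < r ]* spanningCoeff r k (suc ∣ A ∣)) + nonspanningSum n ρ₀ r k
      ≡⟨ sumSubsets-+ n _ _ ⟨
    sumSubsets n (λ A → [ ρ₀ A < r ]* spanningCoeff r k (suc ∣ A ∣)
                        + [ ρ₀ A < r ]* spanningCoeff r k ∣ A ∣)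
      ≡⟨ sumSubsets-cong n (λ A → [<]*-+ (ρ₀ A) r _ _) ⟨
    sumSubsets n (λ A → [ ρ₀ A < r ]* (spanningCoeff r k (suc ∣ A ∣) + spanningCoeff r k ∣ A ∣))
      ∎
    where open ≡-Reasoning

  nonspanningCriterion-loop : ∀ r j → (∀ A → ρ₁ A ≡ ρ₀ A) →
    NonspanningCriterion n ρ₀ r j → NonspanningCriterion (suc n) ρ r (suc j)
  nonspanningCriterion-loop r j loop criterion =
    PositiveIff-resp (sym sum≡) (mk⇔ to from) criterion
    where
    sum≡ : nonspanningSum (suc n) ρ r (suc j) ≡ nonspanningSum n ρ₀ r j
    sum≡ = trans (nonspanningSum-loop r (suc j) loop)
                 (sumSubsets-cong n (λ A → cong ([_<_]*_ (ρ₀ A) r) (spanningCoeff-pascal r j ∣ A ∣)))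
    to : LargeNonspanning ρ₀ r j → LargeNonspanning ρ r (suc j)
    to (A , ρ₀A<r , large) = true ∷ A , subst (_< r) (sym (loop A)) ρ₀A<r ,
                             subst (_≤ suc ∣ A ∣) (sym (+-suc r j)) (s≤s large)
    from : LargeNonspanning ρ r (suc j) → LargeNonspanning ρ₀ r j
    from (true  ∷ A , ρ₁A<r , large) =
      A , subst (_< r) (loop A) ρ₁A<r , s≤s⁻¹ (subst (_≤ suc ∣ A ∣) (+-suc r j) large)
    from (false ∷ A , ρ₀A<r , large) = A , ρ₀A<r , ≤-trans (+-monoʳ-≤ r (n≤1+n j)) large

  nonspanningCriterion-loop₀ : ∀ r → (∀ A → ρ₁ A ≡ ρ₀ A) → (∀ A → ρ₀ A ≤ ∣ A ∣) →
    NonspanningCriterion (suc n) ρ r 0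
  nonspanningCriterion-loop₀ r loop ρ₀-bounded =
    PositiveIff-resp (sym sum≡) (mk⇔ to from)
      (PositiveIff-sumSubsets n (λ A → PositiveIff-[<]* (ρ₀ A) r (PositiveIff-δ r (suc ∣ A ∣))))
    where
    sum≡ : nonspanningSum (suc n) ρ r 0 ≡ sumSubsets n (λ A → [ ρ₀ A < r ]* δ r (suc ∣ A ∣))
    sum≡ = trans (nonspanningSum-loop r 0 loop)
                 (sumSubsets-cong n (λ A → cong ([_<_]*_ (ρ₀ A) r) (spanningCoeff-pascal₀ r ∣ A ∣)))
    to : (∃ λ A → ρ₀ A < r × r ≡ suc ∣ A ∣) → LargeNonspanning ρ r 0
    to (A , ρ₀A<r , r≡1+∣A∣) =
      true ∷ A , subst (_< r) (sym (loop A)) ρ₀A<r , ≤-reflexive (trans (+-identityʳ r) r≡1+∣A∣)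
    from : ∀ {r} → LargeNonspanning ρ r 0 → ∃ λ A → ρ₀ A < r × r ≡ suc ∣ A ∣
    from {suc r} (B , _ , large) with subsetOfSize {n} {r} r≤n
      where
      r≤n : r ≤ n
      r≤n = s≤s⁻¹ (≤-trans (subst (_≤ ∣ B ∣) (+-identityʳ (suc r)) large) (∣p∣≤n B))
    ... | A , ∣A∣≡r = A , s≤s (subst (ρ₀ A ≤_) ∣A∣≡r (ρ₀-bounded A)) , cong suc (sym ∣A∣≡r)

  nonspanningCriterion-neither : ∀ r j → (∀ A → 0 < ρ₁ A) →
    NonspanningCriterion n ρ₀ (suc r) j → NonspanningCriterion n (λ A → ρ₁ A ∸ 1) r j →
    NonspanningCriterion (suc n) ρ (suc r) j
  nonspanningCriterion-neither r j ρ₁>0 deletion contraction =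
    PositiveIff-resp (cong (_+ nonspanningSum n ρ₀ (suc r) j) (sumSubsets-cong n (shift ∘ ρ₁>0)))
      (mk⇔ to from) (PositiveIff-+ contraction deletion)
    where
    shift : ∀ {x v} → 0 < x → [ x ∸ 1 < r ]* v ≡ [ x < suc r ]* v
    shift {suc x} _ = refl
    pred<⇔< : ∀ {x} → 0 < x → x ∸ 1 < r ⇔ x < suc r
    pred<⇔< {suc x} _ = mk⇔ s≤s s≤s⁻¹
    to : LargeNonspanning (λ A → ρ₁ A ∸ 1) r j ⊎ LargeNonspanning ρ₀ (suc r) j →
         LargeNonspanning ρ (suc r) j
    to (inj₁ (A , lt , large)) = true ∷ A , Equivalence.to (pred<⇔< (ρ₁>0 A)) lt , s≤s large
    to (inj₂ (A , lt , large)) = false ∷ A , lt , large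
    from : LargeNonspanning ρ (suc r) j →
           LargeNonspanning (λ A → ρ₁ A ∸ 1) r j ⊎ LargeNonspanning ρ₀ (suc r) j
    from (true  ∷ A , lt , s≤s large) = inj₁ (A , Equivalence.from (pred<⇔< (ρ₁>0 A)) lt , large)
    from (false ∷ A , lt , large)     = inj₂ (A , lt , large)

1+[m∸1]≡m : ∀ {m} → 1 ≤ m → suc (m ∸ 1) ≡ m
1+[m∸1]≡m (s≤s _) = refl

∸-mono-+-≤ : ∀ c {x y a b} → c ≤ x → c ≤ y → c ≤ a → c ≤ b →
             x ℕ.+ y ≤ a ℕ.+ b → (x ∸ c) ℕ.+ (y ∸ c) ≤ (a ∸ c) ℕ.+ (b ∸ c)
∸-mono-+-≤ zero    _ _ _ _ le = le
∸-mono-+-≤ (suc c) {suc x} {suc y} {suc a} {suc b} (s≤s c≤x) (s≤s c≤y) (s≤s c≤a) (s≤s c≤b) le =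
  ∸-mono-+-≤ c c≤x c≤y c≤a c≤b (s≤s⁻¹ (subst₂ _≤_ (+-suc x y) (+-suc a b) (s≤s⁻¹ le)))

rk-∪-≤ : ∀ {n} (M : Matroid n) A B → rk M (A ∪ B) ≤ rk M A ℕ.+ rk M B
rk-∪-≤ M A B = m+n≤o⇒m≤o (rk M (A ∪ B)) (rk-submod M A B)

rk-⁅⁆-≤1 : ∀ {n} (M : Matroid n) i → rk M ⁅ i ⁆ ≤ 1
rk-⁅⁆-≤1 M i = subst (rk M ⁅ i ⁆ ≤_) (∣⁅x⁆∣≡1 i) (rk-bounded M ⁅ i ⁆)

module _ {n} (M : Matroid (suc n)) where

  private
    ρ₀ ρ₁ : Subset n → ℕ
    ρ₀ A = rk M (false ∷ A)
    ρ₁ A = rk M (true ∷ A)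

  delete₀ : Matroid n
  delete₀ = record
    { rk          = ρ₀
    ; rk-bounded  = λ A → rk-bounded M (false ∷ A)
    ; rk-monotone = λ A⊆B → rk-monotone M (s⊆s A⊆B)
    ; rk-submod   = λ A B → rk-submod M (false ∷ A) (false ∷ B)
    }

  rk-insert₀-≤ : ∀ A → ρ₁ A ≤ ρ₀ A ℕ.+ rk M ⁅ zero ⁆
  rk-insert₀-≤ A = subst (λ Z → rk M (true ∷ Z) ≤ ρ₀ A ℕ.+ rk M ⁅ zero ⁆) (∪-identityʳ A)
                         (rk-∪-≤ M (false ∷ A) ⁅ zero ⁆)

  rk-⁅0⁆≤rk-insert₀ : ∀ A → rk M ⁅ zero ⁆ ≤ ρ₁ A
  rk-⁅0⁆≤rk-insert₀ A = rk-monotone M (s⊆s (⊆-min A))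

  contract₀ : Matroid n
  contract₀ = record
    { rk          = λ A → ρ₁ A ∸ rk M ⁅ zero ⁆
    ; rk-bounded  = λ A → m≤n+o⇒m∸n≤o (ρ₁ A) (rk M ⁅ zero ⁆)
        (subst (ρ₁ A ≤_) (+-comm ∣ A ∣ (rk M ⁅ zero ⁆))
          (≤-trans (rk-insert₀-≤ A) (+-monoˡ-≤ (rk M ⁅ zero ⁆) (rk-bounded M (false ∷ A)))))
    ; rk-monotone = λ A⊆B → ∸-monoˡ-≤ (rk M ⁅ zero ⁆) (rk-monotone M (s⊆s A⊆B))
    ; rk-submod   = λ A B → ∸-mono-+-≤ (rk M ⁅ zero ⁆)
        (rk-⁅0⁆≤rk-insert₀ (A ∪ B)) (rk-⁅0⁆≤rk-insert₀ (A ∩ B)) (rk-⁅0⁆≤rk-insert₀ A) (rk-⁅0⁆≤rk-insert₀ B)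
        (rk-submod M (true ∷ A) (true ∷ B))
    }

  rk-≤-insert₀ : ∀ A → ρ₀ A ≤ ρ₁ A
  rk-≤-insert₀ A = rk-monotone M (out⊆ ⊆-refl)

  rk-insert₀-loop : rk M ⁅ zero ⁆ ≡ 0 → ∀ A → ρ₁ A ≡ ρ₀ A
  rk-insert₀-loop isLoop A = ≤-antisym
    (subst (ρ₁ A ≤_) (trans (cong (ρ₀ A ℕ.+_) isLoop) (+-identityʳ (ρ₀ A))) (rk-insert₀-≤ A))
    (rk-≤-insert₀ A)

  rk-insert₀-coloop : rank delete₀ < rank M → ∀ A → ρ₁ A ≡ suc (ρ₀ A)
  rk-insert₀-coloop isColoop A = ≤-antisym ρ₁≤1+ρ₀ 1+ρ₀≤ρ₁
    where
    ρ₁≤1+ρ₀ : ρ₁ A ≤ suc (ρ₀ A)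
    ρ₁≤1+ρ₀ = ≤-trans (rk-insert₀-≤ A) (subst (ρ₀ A ℕ.+ rk M ⁅ zero ⁆ ≤_) (+-comm (ρ₀ A) 1)
                                               (+-monoʳ-≤ (ρ₀ A) (rk-⁅⁆-≤1 M zero)))
    submod : rank M ℕ.+ ρ₀ A ≤ ρ₀ ⊤ ℕ.+ ρ₁ A
    submod = subst₂ (λ X Y → rk M (true ∷ X) ℕ.+ rk M (false ∷ Y) ≤ ρ₀ ⊤ ℕ.+ ρ₁ A)
               (∪-zeroˡ A) (∩-identityˡ A) (rk-submod M (false ∷ ⊤) (true ∷ A))
    1+ρ₀≤ρ₁ : suc (ρ₀ A) ≤ ρ₁ A
    1+ρ₀≤ρ₁ = +-cancelˡ-≤ (ρ₀ ⊤) _ _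
      (subst (_≤ ρ₀ ⊤ ℕ.+ ρ₁ A) (sym (+-suc (ρ₀ ⊤) (ρ₀ A)))
             (≤-trans (+-monoˡ-≤ (ρ₀ A) isColoop) submod))

nonspanningCriterion : ∀ {n} (M : Matroid n) j → NonspanningCriterion n (rk M) (rank M) j
nonspanningCriterion {zero}  M j =
  subst (λ r → NonspanningCriterion 0 (rk M) r j) (sym (n≤0⇒n≡0 (rk-bounded M ⊤)))
        (nonspanningCriterion-empty (rk M) j)
nonspanningCriterion {suc n} M j with rk M ⁅ zero ⁆ ≟ 0 | rank (delete₀ M) <? rank M | j
... | yes isLoop | _ | zero =
  nonspanningCriterion-loop₀ (rk M) (rank M) (rk-insert₀-loop M isLoop) (rk-bounded (delete₀ M))
... | yes isLoop | _ | suc j =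
  nonspanningCriterion-loop (rk M) (rank M) j (rk-insert₀-loop M isLoop)
    (subst (λ r → NonspanningCriterion n (rk (delete₀ M)) r j) (sym (rk-insert₀-loop M isLoop ⊤))
           (nonspanningCriterion (delete₀ M) j))
... | no _ | yes isColoop | j =
  subst (λ r → NonspanningCriterion (suc n) (rk M) r j) (sym (rk-insert₀-coloop M isColoop ⊤))
    (nonspanningCriterion-coloop (rk M) (rank (delete₀ M)) j (rk-insert₀-coloop M isColoop)
       (λ A → rk-monotone (delete₀ M) ⊆⊤) (nonspanningCriterion (delete₀ M) j))
... | no notLoop | no notColoop | j =
  subst (λ r → NonspanningCriterion (suc n) (rk M) r j) 1+[r∸1]≡r
    (nonspanningCriterion-neither (rk M) (rank M ∸ 1) j ρ₁>0
      (subst (λ r → NonspanningCriterion n (rk (delete₀ M)) r j)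
             (trans rank-delete (sym 1+[r∸1]≡r)) (nonspanningCriterion (delete₀ M) j))
      (subst (λ c → NonspanningCriterion n (λ A → rk M (true ∷ A) ∸ c) (rank M ∸ c) j) c≡1
             (nonspanningCriterion (contract₀ M) j)))
  where
  c≡1 : rk M ⁅ zero ⁆ ≡ 1
  c≡1 = ≤-antisym (rk-⁅⁆-≤1 M zero) (n≢0⇒n>0 notLoop)
  ρ₁>0 : ∀ A → 0 < rk M (true ∷ A)
  ρ₁>0 A = subst (_≤ rk M (true ∷ A)) c≡1 (rk-⁅0⁆≤rk-insert₀ M A)
  1+[r∸1]≡r : suc (rank M ∸ 1) ≡ rank M
  1+[r∸1]≡r = 1+[m∸1]≡m (ρ₁>0 ⊤)
  rank-delete : rank (delete₀ M) ≡ rank M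
  rank-delete = ≤-antisym (rk-≤-insert₀ M ⊤) (≮⇒≥ notColoop)

module _ {n} (M : Matroid n) where

  rk-insert-≤ : ∀ H e → rk M (H ∪ ⁅ e ⁆) ≤ suc (rk M H)
  rk-insert-≤ H e = ≤-trans (rk-∪-≤ M H ⁅ e ⁆)
    (subst (rk M H ℕ.+ rk M ⁅ e ⁆ ≤_) (+-comm (rk M H) 1) (+-monoʳ-≤ (rk M H) (rk-⁅⁆-≤1 M e)))

  Saturates : Subset n → List (Fin n) → Set
  Saturates H es = ∀ {e} → e ∈ₗ es → e ∈ H ⊎ rank M ≤ rk M (H ∪ ⁅ e ⁆)

  saturate : ∀ es A → rk M A < rank M → ∃ λ H → A ⊆ H × rk M H < rank M × Saturates H es
  saturate []       A A<r = A , id , A<r , λ ()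
  saturate (e ∷ es) A A<r with rk M (A ∪ ⁅ e ⁆) <? rank M
  ... | yes A+e<r =
    let H , A+e⊆H , H<r , sat = saturate es (A ∪ ⁅ e ⁆) A+e<r
    in H , A+e⊆H ∘ p⊆p∪q ⁅ e ⁆ , H<r , λ where
         (here refl)   → inj₁ (A+e⊆H (q⊆p∪q A ⁅ e ⁆ (x∈⁅x⁆ e)))
         (there e′∈es) → sat e′∈es
  ... | no  A+e≮r =
    let H , A⊆H , H<r , sat = saturate es A A<r
    in H , A⊆H , H<r , λ where
         (here refl)   → inj₂ (≤-trans (≮⇒≥ A+e≮r) (rk-monotone M (∪-monoˡ A⊆H)))
         (there e′∈es) → sat e′∈es
    where
    ∪-monoˡ : ∀ {X Y} → X ⊆ Y → X ∪ ⁅ e ⁆ ⊆ Y ∪ ⁅ e ⁆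
    ∪-monoˡ {X} X⊆Y x∈X+e = x∈p∪q⁺ (map₁ X⊆Y (x∈p∪q⁻ X ⁅ e ⁆ x∈X+e))

  saturated⇒flat : ∀ {H} → rk M H < rank M → Saturates H (allFin n) → IsFlat M H
  saturated⇒flat {H} H<r sat e = mk⇔ to from
    where
    to : rk M (H ∪ ⁅ e ⁆) ≡ rk M H → e ∈ H
    to same =
      [ id , (λ r≤ → contradiction (subst (rank M ≤_) same r≤) (<⇒≱ H<r)) ] (sat (∈-allFin e))
    H+e⊆H : e ∈ H → H ∪ ⁅ e ⁆ ⊆ H
    H+e⊆H e∈H x∈H+e =
      [ id , (λ x∈e → subst (_∈ H) (sym (x∈⁅y⁆⇒x≡y e x∈e)) e∈H) ] (x∈p∪q⁻ H ⁅ e ⁆ x∈H+e)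
    from : e ∈ H → rk M (H ∪ ⁅ e ⁆) ≡ rk M H
    from e∈H = ≤-antisym (rk-monotone M (H+e⊆H e∈H)) (rk-monotone M (p⊆p∪q ⁅ e ⁆))

  saturated⇒rank : ∀ {H} → rk M H < rank M → Saturates H (allFin n) → rk M H ℕ.+ 1 ≡ rank M
  saturated⇒rank {H} H<r sat with all? (_∈? H)
  ... | yes ⊤⊆H = contradiction (rk-monotone M (λ {x} _ → ⊤⊆H x)) (<⇒≱ H<r)
  ... | no  ⊤⊈H with ¬∀⟶∃¬ n (_∈ H) (_∈? H) ⊤⊈H
  ...   | e , e∉H =
    trans (+-comm (rk M H) 1) (≤-antisym H<r (≤-trans r≤rk[H+e] (rk-insert-≤ H e)))
    where
    r≤rk[H+e] : rank M ≤ rk M (H ∪ ⁅ e ⁆)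
    r≤rk[H+e] = [ (λ e∈H → contradiction e∈H e∉H) , id ] (sat (∈-allFin e))

  nonspanning⊆hyperplane : ∀ A → rk M A < rank M → ∃ λ H → A ⊆ H × IsHyperplane M H
  nonspanning⊆hyperplane A A<r =
    let H , A⊆H , H<r , sat = saturate (allFin n) A A<r
    in H , A⊆H , saturated⇒flat H<r sat , saturated⇒rank H<r sat

∈-allSubsets : ∀ n (A : Subset n) → A ∈ₗ allSubsets n
∈-allSubsets zero    []          = here refl
∈-allSubsets (suc n) (true  ∷ A) = ∈-++⁺ˡ (∈-map⁺ (true ∷_) (∈-allSubsets n A))
∈-allSubsets (suc n) (false ∷ A) =
  ∈-++⁺ʳ (map (true ∷_) (allSubsets n)) (∈-map⁺ (false ∷_) (∈-allSubsets n A))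

module _ {n} (M : Matroid n) where

  hyperplane≤f1 : ∀ {H} → IsHyperplane M H → ∣ H ∣ ≤ f1 M
  hyperplane≤f1 {H} H-hyp =
    foldr-preservesᵒ {P = ∣ H ∣ ≤_} (λ x y → [ m≤n⇒m≤n⊔o y , m≤n⇒m≤o⊔n x ]) 0 _
      (inj₂ (Anyₚ.map⁺ (Any.map (λ { refl → ≤-refl }) H∈hyperplanes)))
    where
    H∈hyperplanes : H ∈ₗ filter (isHyperplane? M) (allSubsets n)
    H∈hyperplanes = ∈-filter⁺ (isHyperplane? M) (∈-allSubsets n H) H-hyp

  f1<⁺ : ∀ {k} → 0 < k → (∀ H → IsHyperplane M H → ∣ H ∣ < k) → f1 M < k
  f1<⁺ {k} k>0 bound = foldr-preservesᵇ {P = _< k} ⊔-pres-<m k>0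
    (Allₚ.map⁺ (All.map (bound _) (Allₚ.all-filter (isHyperplane? M) (allSubsets n))))

  f1<⇔¬LargeNonspanning : ∀ j → 1 ≤ rank M →
                          f1 M < j ℕ.+ rank M ⇔ (¬ LargeNonspanning (rk M) (rank M) j)
  f1<⇔¬LargeNonspanning j r≥1 = mk⇔ to from
    where
    to : f1 M < j ℕ.+ rank M → ¬ LargeNonspanning (rk M) (rank M) j
    to f1<j+r (A , A<r , large) =
      let H , A⊆H , H-hyp = nonspanning⊆hyperplane M A A<r
      in <⇒≱ f1<j+r (subst (_≤ f1 M) (+-comm (rank M) j)
                       (≤-trans large (≤-trans (p⊆q⇒∣p∣≤∣q∣ A⊆H) (hyperplane≤f1 H-hyp))))
    from : ¬ LargeNonspanning (rk M) (rank M) j → f1 M < j ℕ.+ rank M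
    from noLarge = f1<⁺ (≤-trans r≥1 (m≤n+m (rank M) j)) bound
      where
      bound : ∀ H → IsHyperplane M H → ∣ H ∣ < j ℕ.+ rank M
      bound H (_ , rk+1≡r) with ∣ H ∣ <? j ℕ.+ rank M
      ... | yes small = small
      ... | no  big   = contradiction
        (H , subst (rk M H <_) rk+1≡r (subst (_≤ rk M H ℕ.+ 1) (+-comm (rk M H) 1) ≤-refl) ,
             subst (_≤ ∣ H ∣) (+-comm j (rank M)) (≮⇒≥ big))
        noLarge

termCoeff+nonspanning : ∀ {ρ r s} j → ρ ≤ r → ρ ≤ s →
  termCoeff (r ∸ ρ) (s ∸ ρ) j + [ ρ < r ]* spanningCoeff r j s ≡ spanningCoeff r j s
termCoeff+nonspanning {ρ} {r} {s} j ρ≤r ρ≤s with ρ <? r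
... | yes ρ<r =
  trans (cong₂ _+_ (termCoeff-suc (m<n⇒0<n∸m ρ<r)) ([<]*-< _ ρ<r)) (ℤ.+-identityˡ _)
  where
  termCoeff-suc : ∀ {a} → 0 < a → termCoeff a (s ∸ ρ) j ≡ + 0
  termCoeff-suc {suc a} _ = refl
... | no  ρ≮r rewrite ≤-antisym ρ≤r (≮⇒≥ ρ≮r) =
  trans (cong₂ _+_ (cong (λ a → termCoeff a (s ∸ r) j) (n∸n≡0 r)) ([<]*-≥ {r} {r} _ ≤-refl))
        (trans (ℤ.+-identityʳ _) (sym (spanningCoeff-≤ j ρ≤s)))

coeff-tutte1y+nonspanningSum : ∀ {n} (M : Matroid n) j → 1 ≤ rank M →
  coeff (tutte1y M) j + nonspanningSum n (rk M) (rank M) j ≡ binomℤ (+ n -ℤ + j -ℤ + 1) (rank M ∸ 1)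
coeff-tutte1y+nonspanningSum {n} M j r≥1 = begin
  coeff (tutte1y M) j + nonspanningSum n (rk M) r j
    ≡⟨ cong (_+ nonspanningSum n (rk M) r j) (coeff-tutte1y M j) ⟩
  sumSubsets n (λ A → termCoeff (r ∸ rk M A) (∣ A ∣ ∸ rk M A) j) + nonspanningSum n (rk M) r j
    ≡⟨ sumSubsets-+ n _ _ ⟨
  sumSubsets n (λ A → termCoeff (r ∸ rk M A) (∣ A ∣ ∸ rk M A) j
                      + [ rk M A < r ]* spanningCoeff r j ∣ A ∣)
    ≡⟨ sumSubsets-cong n (λ A → termCoeff+nonspanning j (rk-monotone M ⊆⊤) (rk-bounded M A)) ⟩
  sumSubsets n (λ A → spanningCoeff r j ∣ A ∣)
    ≡⟨ cong (λ r′ → sumSubsets n (λ A → spanningCoeff r′ j ∣ A ∣)) (1+[m∸1]≡m r≥1) ⟨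
  sumSubsets n (λ A → spanningCoeff (suc (r ∸ 1)) j ∣ A ∣)
    ≡⟨ sumSubsets-spanningCoeff n (r ∸ 1) j ⟩
  + binom∸ n j (r ∸ 1)
    ≡⟨ binomℤ≡binom∸ n j (r ∸ 1) ⟨
  binomℤ (+ n -ℤ + j -ℤ + 1) (r ∸ 1)
    ∎
  where
  open ≡-Reasoning
  r : ℕ
  r = rank M

c+s≡b⇒[s≡0⇔c≡b] : ∀ {c s b} → c + s ≡ b → s ≡ + 0 ⇔ c ≡ b
c+s≡b⇒[s≡0⇔c≡b] {c} {s} {b} c+s≡b = mk⇔ to from
  where
  to : s ≡ + 0 → c ≡ b
  to s≡0 = trans (sym (ℤ.+-identityʳ c)) (trans (cong (_+_ c) (sym s≡0)) c+s≡b)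
  from : c ≡ b → s ≡ + 0
  from c≡b = +-identityʳ-unique c s (trans c+s≡b (sym c≡b))

theorem3p3 : ∀ {n} (M : Matroid n) (j : ℕ) → 1 ≤ rank M →
    (f1 M < j ℕ.+ rank M) ⇔ (PZ.coeff (tutte1y M) j ≡ binomℤ (+ n -ℤ + j -ℤ + 1) (rank M ∸ 1))
theorem3p3 M j r≥1 =
  ⇔-trans (f1<⇔¬LargeNonspanning M j r≥1)
    (⇔-trans (⇔-sym (PositiveIff⇒≡0⇔¬ (nonspanningCriterion M j)))
             (c+s≡b⇒[s≡0⇔c≡b] (coeff-tutte1y+nonspanningSum M j r≥1)))
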